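{- For every $k \in \{1,2,3,4\}$ and every $\Delta \ge 3$, $k$ is forcing for $\mathcal{G}_\Delta$, where $\mathcal{G}_\Delta$ is any family with $\mathcal{T}_\Delta \subseteq \mathcal{G}_\Delta \subseteq \mathcal{C}_\Delta$.
   Context: A weighing of a graph $G$ is a function $w: E(G) \to \{ -1,1\}$; $w(H)=\sum_{e\in E(H)} w(e)$ for a subgraph $H$. $w$ is $k$-local positive if $w(H)>0$ for every connected subgraph $H$ of $G$ with exactly $k$ edges. For an infinite family $\mathcal{G}$ of connected graphs, $k$ is forcing for $\mathcal{G}$ if for all but finitely many $G\in\mathcal{G}$, every $k$-local positive weighing $w$ of $G$ satisfies $w(G)>0$. $\mathcal{C}_\Delta$ is the family of all connected graphs with maximum degree at most $\Delta$, and $\mathcal{T}_\Delta$ the family of all trees with maximum degree at most $\Delta$. -}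

module Defs where

open import Data.Nat using (ℕ; zero; suc; _≤_; _<ᵇ_; _≡ᵇ_)
open import Data.Fin using (Fin; toℕ)
import Data.Fin as F
open import Data.Integer using (ℤ; _+_; +_; -_; _<_)
open import Data.Bool using (Bool; true; false; _∧_; _∨_; if_then_else_)
open import Data.Sign using (Sign)
open import Data.Product using (Σ; _×_; ∃)
open import Relation.Binary.PropositionalEquality using (_≡_)
open import Relation.Nullary using (¬_)

record Graph (n : ℕ) : Set where
  field
    adj    : Fin n → Fin n → Bool
    adjSym : ∀ i j → adj i j ≡ adj j i
    loopless : ∀ i → adj i i ≡ false
open Graph public

sumℤ : ∀ {n} → (Fin n → ℤ) → ℤ
sumℤ {zero}  f = + 0
sumℤ {suc n} f = f F.zero + sumℤ (λ i → f (F.suc i))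

sumℕ : ∀ {n} → (Fin n → ℕ) → ℕ
sumℕ {zero}  f = 0
sumℕ {suc n} f = f F.zero Data.Nat.+ sumℕ (λ i → f (F.suc i))

-- An edge set on Fin n is a Bool relation; an unordered pair {i,j} is
-- represented by the ordered pair (i,j) with i < j.
EdgeRel : ℕ → Set
EdgeRel n = Fin n → Fin n → Bool

edgeCount : ∀ {n} → EdgeRel n → ℕ
edgeCount {n} S = sumℕ λ i → sumℕ λ j →
  if S i j ∧ (toℕ i <ᵇ toℕ j) then 1 else 0

degree : ∀ {n} → Graph n → Fin n → ℕ
degree G v = sumℕ λ j → if adj G v j then 1 else 0

MaxDegreeAtMost : ∀ {n} → Graph n → ℕ → Set
MaxDegreeAtMost G Δ = ∀ v → degree G v ≤ Δ

data Reach {n} (S : EdgeRel n) : Fin n → Fin n → Set where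
  here : ∀ {u} → Reach S u u
  step : ∀ {u x v} → S u x ≡ true → Reach S x v → Reach S u v

Connected : ∀ {n} → Graph n → Set
Connected {n} G = ∀ (u v : Fin n) → Reach (adj G) u v

removeEdge : ∀ {n} → EdgeRel n → Fin n → Fin n → EdgeRel n
removeEdge S a b i j =
  if ((toℕ i ≡ᵇ toℕ a) ∧ (toℕ j ≡ᵇ toℕ b)) ∨ ((toℕ i ≡ᵇ toℕ b) ∧ (toℕ j ≡ᵇ toℕ a))
  then false else S i j

-- acyclic: every edge is a bridge (its endpoints are disconnected
-- after removing it), equivalently no cycle
Acyclic : ∀ {n} → Graph n → Set
Acyclic G = ∀ a b → adj G a b ≡ true → ¬ Reach (removeEdge (adj G) a b) a b

IsTree : ∀ {n} → Graph n → Set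
IsTree {n} G = (1 ≤ n) × Connected G × Acyclic G

-- a (not necessarily induced) subgraph of G given by an edge set S ⊆ E(G);
-- its vertex set is the set of vertices incident to edges of S
IsEdgeSubgraph : ∀ {n} → Graph n → EdgeRel n → Set
IsEdgeSubgraph G S = (∀ i j → S i j ≡ S j i) × (∀ i j → S i j ≡ true → adj G i j ≡ true)

Incident : ∀ {n} → EdgeRel n → Fin n → Set
Incident S u = ∃ λ x → S u x ≡ true

SubConnected : ∀ {n} → EdgeRel n → Set
SubConnected S = ∀ u v → Incident S u → Incident S v → Reach S u v

-- weighings: values ±1 (a Sign) on pairs; only the values on edges (i,j),
-- i < j, are ever used
Weighing : ℕ → Set
Weighing n = Fin n → Fin n → Sign

signℤ : Sign → ℤ
signℤ Sign.+ = + 1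
signℤ Sign.- = - (+ 1)

weightOf : ∀ {n} → Weighing n → EdgeRel n → ℤ
weightOf w S = sumℤ λ i → sumℤ λ j →
  if S i j ∧ (toℕ i <ᵇ toℕ j) then signℤ (w i j) else + 0

LocalPositive : ∀ {n} → ℕ → Graph n → Weighing n → Set
LocalPositive k G w = ∀ S → IsEdgeSubgraph G S → SubConnected S →
  edgeCount S ≡ k → + 0 < weightOf w S

Family : Set₁
Family = (n : ℕ) → Graph n → Set

-- k is forcing: for all but finitely many G in the family (equivalently,
-- for graphs of bounded degree, all G with at least N vertices), every
-- k-local positive weighing has positive total weight
Forcing : ℕ → Family → Set
Forcing k 𝒢 = Σ ℕ λ N → ∀ n → N ≤ n → ∀ (G : Graph n) → 𝒢 n G →
  ∀ (w : Weighing n) → LocalPositive k G w → + 0 < weightOf w (adj G)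

module Submission where

-- Let G be connected with maximum degree Δ and n ≥ Δ² + Δ + 2 vertices, and let
-- w be a k-local positive weighing, 1 ≤ k ≤ 4.  Write N(x), P(x) for the numbers
-- of negative and positive edges at x.
--  * Growing pieces.  Since n ≥ 2k, every connected edge set with at most k edges
--    extends to a connected one with exactly k edges; so no connected piece with
--    at most k edges may contain t negative edges with k ≤ 2t.  For k ≤ 2 this
--    excludes negative edges, for k ∈ {3,4} two adjacent negative edges and a
--    path negative–positive–negative.  Hence N(x) ≤ 1 for every x, and
--    N(x) + N(y) ≤ 1 for every positive edge xy.
--  * Charging.  With A = Σₓ N(x)P(x), double counting gives
--    Σₓ N(x) ≤ 2A ≤ Σₓ P(x): the first inequality because a negative edge xy has
--    P(x) + P(y) ≥ 1 (its endpoints are not a whole component), the second by the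
--    bound on positive edges.  So #negative ≤ #positive.
--  * Strictness.  If both inequalities were equalities, some vertex c has N(c) = 0
--    and every vertex is within distance 2 of c, so n ≤ 1 + Δ + Δ², a contradiction.

open import Defs
open import Data.Nat as ℕ using (ℕ; zero; suc; _≤_; _<_; _+_; _*_; _∸_; z≤n; s≤s; _≤?_; _<?_; _<ᵇ_)
open import Data.Nat.Properties hiding (_≟_)
import Data.Nat.Tactic.RingSolver as ℕSolver
open import Data.Integer as ℤ using (ℤ)
import Data.Integer.Properties as ℤP
import Data.Integer.Tactic.RingSolver as ℤSolver
open import Data.Fin as F using (Fin; toℕ; _≟_)
import Data.Fin.Properties as FP
open import Data.Bool as 𝔹 using (Bool; true; false; _∧_; _∨_; not; if_then_else_; T)
import Data.Bool.Properties as BP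
open import Data.Sign using (Sign)
open import Data.Product using (_×_; _,_; ∃; ∃₂; proj₁; proj₂)
open import Data.Sum using (_⊎_; inj₁; inj₂)
open import Data.List using (List; []; _∷_; length; lookup)
open import Data.List.Membership.Propositional using (_∈_; _∉_)
open import Data.List.Relation.Unary.Any using (here; there; index)
open import Data.List.Relation.Unary.Any.Properties using (lookup-index)
open import Data.Empty using (⊥; ⊥-elim)
open import Data.Unit using (tt)
open import Relation.Nullary using (¬_; Dec; yes; no; does; ¬?)
open import Relation.Nullary.Decidable using (_×-dec_)
open import Relation.Binary.Definitions using (tri<; tri≈; tri>)
open import Relation.Binary.PropositionalEquality

sum-cong : ∀ {n} {f g : Fin n → ℕ} → (∀ i → f i ≡ g i) → sumℕ f ≡ sumℕ g
sum-cong {zero}  h = refl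
sum-cong {suc n} h = cong₂ _+_ (h F.zero) (sum-cong (λ i → h (F.suc i)))

sum-zero : ∀ {n} {f : Fin n → ℕ} → (∀ i → f i ≡ 0) → sumℕ f ≡ 0
sum-zero {zero}  h = refl
sum-zero {suc n} h = cong₂ _+_ (h F.zero) (sum-zero (λ i → h (F.suc i)))

sum-+ : ∀ {n} (f g : Fin n → ℕ) → sumℕ (λ i → f i + g i) ≡ sumℕ f + sumℕ g
sum-+ {zero}  f g = refl
sum-+ {suc n} f g = begin
  (f F.zero + g F.zero) + sumℕ (λ i → f (F.suc i) + g (F.suc i))
    ≡⟨ cong ((f F.zero + g F.zero) +_) (sum-+ (λ i → f (F.suc i)) (λ i → g (F.suc i))) ⟩
  (f F.zero + g F.zero) + (sumℕ (λ i → f (F.suc i)) + sumℕ (λ i → g (F.suc i)))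
    ≡⟨ +-exchange (f F.zero) (g F.zero) _ _ ⟩
  sumℕ f + sumℕ g ∎
  where
  open ≡-Reasoning
  +-exchange : ∀ a b c d → (a + b) + (c + d) ≡ (a + c) + (b + d)
  +-exchange = ℕSolver.solve-∀

sum-*ʳ : ∀ {n} (f : Fin n → ℕ) c → sumℕ (λ j → f j * c) ≡ sumℕ f * c
sum-*ʳ {zero}  f c = refl
sum-*ʳ {suc n} f c = trans (cong (f F.zero * c +_) (sum-*ʳ (λ j → f (F.suc j)) c))
  (sym (*-distribʳ-+ c (f F.zero) _))

sum-*ˡ : ∀ {n} (f : Fin n → ℕ) c → sumℕ (λ j → c * f j) ≡ c * sumℕ f
sum-*ˡ f c = trans (sum-cong (λ j → *-comm c (f j))) (trans (sum-*ʳ f c) (*-comm (sumℕ f) c))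

sum-ones : ∀ n → sumℕ {n} (λ _ → 1) ≡ n
sum-ones zero    = refl
sum-ones (suc n) = cong suc (sum-ones n)

sum-delta : ∀ {n} (a : Fin n) (g : Fin n → ℕ) → sumℕ (λ i → if does (i ≟ a) then g i else 0) ≡ g a
sum-delta {suc n} F.zero    g = trans (cong (g F.zero +_) (sum-zero {n} (λ _ → refl))) (+-identityʳ _)
sum-delta {suc n} (F.suc a) g = sum-delta a (λ i → g (F.suc i))

sum-swap : ∀ {n m} (f : Fin n → Fin m → ℕ) →
  sumℕ (λ i → sumℕ (λ j → f i j)) ≡ sumℕ (λ j → sumℕ (λ i → f i j))
sum-swap {zero}  {m} f = sym (sum-zero {m} (λ _ → refl))
sum-swap {suc n} f = trans (cong (sumℕ (f F.zero) +_) (sum-swap (λ i j → f (F.suc i) j)))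
  (sym (sum-+ (f F.zero) (λ j → sumℕ (λ i → f (F.suc i) j))))

sum-mono : ∀ {n} {f g : Fin n → ℕ} → (∀ i → f i ≤ g i) → sumℕ f ≤ sumℕ g
sum-mono {zero}  h = z≤n
sum-mono {suc n} h = +-mono-≤ (h F.zero) (sum-mono (λ i → h (F.suc i)))

sum-mono-< : ∀ {n} {f g : Fin n → ℕ} → (∀ i → f i ≤ g i) → ∀ a → f a < g a → sumℕ f < sumℕ g
sum-mono-< {suc n} h F.zero    lt = +-mono-<-≤ lt (sum-mono (λ i → h (F.suc i)))
sum-mono-< {suc n} h (F.suc a) lt = +-mono-≤-< (h F.zero) (sum-mono-< (λ i → h (F.suc i)) a lt)

term≤sum : ∀ {n} (f : Fin n → ℕ) a → f a ≤ sumℕ f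
term≤sum f F.zero    = m≤m+n _ _
term≤sum f (F.suc a) = ≤-trans (term≤sum (λ i → f (F.suc i)) a) (m≤n+m _ _)

two-terms≤sum : ∀ {n} (f : Fin n → ℕ) a b → a ≢ b → f a + f b ≤ sumℕ f
two-terms≤sum f F.zero    F.zero    a≢b = ⊥-elim (a≢b refl)
two-terms≤sum f F.zero    (F.suc b) a≢b = +-monoʳ-≤ (f F.zero) (term≤sum (λ i → f (F.suc i)) b)
two-terms≤sum f (F.suc a) F.zero    a≢b = subst (_≤ sumℕ f) (+-comm (f F.zero) _)
  (+-monoʳ-≤ (f F.zero) (term≤sum (λ i → f (F.suc i)) a))
two-terms≤sum f (F.suc a) (F.suc b) a≢b =
  ≤-trans (two-terms≤sum (λ i → f (F.suc i)) a b (λ e → a≢b (cong F.suc e))) (m≤n+m _ _)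

sum² : ∀ {n} → (Fin n → Fin n → ℕ) → ℕ
sum² f = sumℕ λ i → sumℕ λ j → f i j

sum²-cong : ∀ {n} {f g : Fin n → Fin n → ℕ} → (∀ i j → f i j ≡ g i j) → sum² f ≡ sum² g
sum²-cong h = sum-cong (λ i → sum-cong (h i))

sum²-+ : ∀ {n} (f g : Fin n → Fin n → ℕ) → sum² (λ i j → f i j + g i j) ≡ sum² f + sum² g
sum²-+ {n} f g = trans (sum-cong (λ i → sum-+ (f i) (g i))) (sum-+ {n} _ _)

sum²-mono : ∀ {n} {f g : Fin n → Fin n → ℕ} → (∀ i j → f i j ≤ g i j) → sum² f ≤ sum² g
sum²-mono h = sum-mono (λ i → sum-mono (h i))

sum²-mono-< : ∀ {n} {f g : Fin n → Fin n → ℕ} → (∀ i j → f i j ≤ g i j) →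
  ∀ a b → f a b < g a b → sum² f < sum² g
sum²-mono-< h a b lt = sum-mono-< (λ i → sum-mono (h i)) a (sum-mono-< (h a) b lt)

term≤sum² : ∀ {n} (f : Fin n → Fin n → ℕ) p q → f p q ≤ sum² f
term≤sum² f p q = ≤-trans (term≤sum (f p) q) (term≤sum (λ i → sumℕ (f i)) p)

two-terms≤sum² : ∀ {n} (f : Fin n → Fin n → ℕ) p q p' q' → ¬ (p ≡ p' × q ≡ q') → f p q + f p' q' ≤ sum² f
two-terms≤sum² f p q p' q' ne with p ≟ p'
... | yes refl = ≤-trans (two-terms≤sum (f p) q q' (λ e → ne (refl , e))) (term≤sum (λ i → sumℕ (f i)) p)
... | no p≢p'  = ≤-trans (+-mono-≤ (term≤sum (f p) q) (term≤sum (f p') q'))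
                         (two-terms≤sum (λ i → sumℕ (f i)) p p' p≢p')

𝟙 : Bool → ℕ
𝟙 b = if b then 1 else 0

∧-true : ∀ {b c} → b ∧ c ≡ true → b ≡ true × c ≡ true
∧-true {true} {true} _ = refl , refl

∨-true : ∀ {b c} → b ∨ c ≡ true → b ≡ true ⊎ c ≡ true
∨-true {true}  _ = inj₁ refl
∨-true {false} e = inj₂ e

∧₃-true : ∀ {x y z} → x ≡ true → y ≡ true → z ≡ true → (x ∧ y) ∧ z ≡ true
∧₃-true refl refl refl = refl

not-true : ∀ {b} → ¬ (b ≡ true) → b ≡ false
not-true {true}  h = ⊥-elim (h refl)
not-true {false} h = refl

𝟙-mono : ∀ {b c} → (b ≡ true → c ≡ true) → 𝟙 b ≤ 𝟙 c
𝟙-mono {false} h = z≤n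
𝟙-mono {true}  h rewrite h refl = ≤-refl

𝟙-split : ∀ b p → 𝟙 b ≡ 𝟙 (b ∧ p) + 𝟙 (b ∧ not p)
𝟙-split true  true  = refl
𝟙-split true  false = refl
𝟙-split false p     = refl

𝟙-∨ : ∀ p s l → (p ≡ true → s ≡ false) → 𝟙 ((p ∨ s) ∧ l) ≡ 𝟙 (p ∧ l) + 𝟙 (s ∧ l)
𝟙-∨ true  s true  h rewrite h refl = refl
𝟙-∨ true  s false h rewrite h refl = refl
𝟙-∨ false s l     h = refl

𝟙≤𝟙* : ∀ b s → (b ≡ true → 1 ≤ s) → 𝟙 b ≤ 𝟙 b * s
𝟙≤𝟙* false s h = z≤n
𝟙≤𝟙* true  s h = ≤-trans (h refl) (≤-reflexive (sym (+-identityʳ s)))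

𝟙*≤𝟙 : ∀ b s → (b ≡ true → s ≤ 1) → 𝟙 b * s ≤ 𝟙 b
𝟙*≤𝟙 false s h = z≤n
𝟙*≤𝟙 true  s h = ≤-trans (≤-reflexive (+-identityʳ s)) (h refl)

count≤1 : ∀ {n} (f : Fin n → Bool) → (∀ a b → f a ≡ true → f b ≡ true → a ≡ b) →
  sumℕ (λ i → 𝟙 (f i)) ≤ 1
count≤1 {zero}  f uniq = z≤n
count≤1 {suc n} f uniq with f F.zero in f0
... | false = count≤1 (λ i → f (F.suc i)) (λ a b p q → FP.suc-injective (uniq _ _ p q))
... | true  = ≤-reflexive (cong suc (sum-zero nowhere-else))
  where
  nowhere-else : ∀ i → 𝟙 (f (F.suc i)) ≡ 0
  nowhere-else i with f (F.suc i) in fi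
  ... | false = refl
  ... | true with uniq _ _ f0 fi
  ... | ()

count≤1⇒unique : ∀ {n} (f : Fin n → Bool) → sumℕ (λ i → 𝟙 (f i)) ≤ 1 →
  ∀ a b → f a ≡ true → f b ≡ true → a ≡ b
count≤1⇒unique f le a b fa fb with a ≟ b
... | yes a≡b = a≡b
... | no a≢b with two-terms≤sum (λ i → 𝟙 (f i)) a b a≢b
... | two≤ rewrite fa | fb = ⊥-elim (1+n≰n (≤-trans two≤ le))

count-witness : ∀ {n} (f : Fin n → Bool) → 1 ≤ sumℕ (λ i → 𝟙 (f i)) → ∃ λ i → f i ≡ true
count-witness {suc n} f le with f F.zero in f0
... | true  = F.zero , f0
... | false with count-witness (λ i → f (F.suc i)) le
... | i , fi = F.suc i , fi

witness⇒count : ∀ {n} (f : Fin n → Bool) {i} → f i ≡ true → 1 ≤ sumℕ (λ j → 𝟙 (f j))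
witness⇒count f {i} fi = ≤-trans (≤-reflexive (cong 𝟙 (sym fi))) (term≤sum (λ j → 𝟙 (f j)) i)

≱1⇒≡0 : ∀ {s} → ¬ (1 ≤ s) → s ≡ 0
≱1⇒≡0 h = n<1⇒n≡0 (≰⇒> h)

lt : ∀ {n} → Fin n → Fin n → Bool
lt i j = toℕ i <ᵇ toℕ j

lt-asym : ∀ {n} (i j : Fin n) → lt i j ≡ true → lt j i ≡ false
lt-asym i j i<j = not-true λ j<i →
  <-asym (<ᵇ⇒< (toℕ i) (toℕ j) (subst T (sym i<j) tt)) (<ᵇ⇒< (toℕ j) (toℕ i) (subst T (sym j<i) tt))

lt-asym-⊥ : ∀ {n} (i j : Fin n) → lt i j ≡ true → lt j i ≡ true → ⊥
lt-asym-⊥ i j i<j j<i with () ← trans (sym j<i) (lt-asym i j i<j)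

lt-tri : ∀ {n} (i j : Fin n) → lt i j ≡ false → lt j i ≡ false → i ≡ j
lt-tri i j i≮j j≮i with <-cmp (toℕ i) (toℕ j)
... | tri< i<j _ _ = ⊥-elim (subst T i≮j (<⇒<ᵇ i<j))
... | tri≈ _ i≡j _ = FP.toℕ-injective i≡j
... | tri> _ _ j<i = ⊥-elim (subst T j≮i (<⇒<ᵇ j<i))

lt-irrefl : ∀ {n} (i : Fin n) → lt i i ≡ false
lt-irrefl i = not-true λ i<i → <-irrefl refl (<ᵇ⇒< (toℕ i) (toℕ i) (subst T (sym i<i) tt))

reach-mono : ∀ {n} {S S' : EdgeRel n} → (∀ i j → S i j ≡ true → S' i j ≡ true) →
  ∀ {u v} → Reach S u v → Reach S' u v
reach-mono h here       = here
reach-mono h (step e r) = step (h _ _ e) (reach-mono h r)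

reach-trans : ∀ {n} {S : EdgeRel n} {u v x} → Reach S u v → Reach S v x → Reach S u x
reach-trans here       r' = r'
reach-trans (step e r) r' = step e (reach-trans r r')

reach-sym : ∀ {n} {S : EdgeRel n} → (∀ i j → S i j ≡ S j i) → ∀ {u v} → Reach S u v → Reach S v u
reach-sym sym-S here = here
reach-sym sym-S (step {u} {x} e r) = reach-trans (reach-sym sym-S r) (step (trans (sym-S x u) e) here)

first-step : ∀ {n} {S : EdgeRel n} {a b} → a ≢ b → Reach S a b → ∃ λ z → S a z ≡ true
first-step a≢b here       = ⊥-elim (a≢b refl)
first-step a≢b (step e _) = _ , e

connected-has-edge : ∀ {n} (G : Graph n) → 2 ≤ n → Connected G → ∃₂ λ a b → adj G a b ≡ true
connected-has-edge G (s≤s (s≤s _)) conn = F.zero , first-step (λ ()) (conn F.zero (F.suc F.zero))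

reach-closed : ∀ {n} {S : EdgeRel n} (X : Fin n → Set) → (∀ v u → X v → S v u ≡ true → X u) →
  ∀ {a v} → X a → Reach S a v → X v
reach-closed X closed xa here       = xa
reach-closed X closed xa (step e r) = reach-closed X closed (closed _ _ xa e) r

outside : ∀ {n} (vs : List (Fin n)) → length vs < n → ∃ λ v → v ∉ vs
outside {n} vs short with FP.any? {n} (λ v → ¬? (v ∈? vs))
  where open import Data.List.Membership.DecPropositional (_≟_ {n}) using (_∈?_)
... | yes missing = missing
... | no  none    = ⊥-elim (FP.<⇒≢ i<j (position-injective fi≡fj))
  where
  open import Data.List.Membership.DecPropositional (_≟_ {n}) using (_∈?_)
  member : ∀ v → v ∈ vs
  member v with v ∈? vs
  ... | yes v∈vs = v∈vs
  ... | no  v∉vs = ⊥-elim (none (v , v∉vs))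
  position : Fin n → Fin (length vs)
  position v = index (member v)
  position-injective : ∀ {i j} → position i ≡ position j → i ≡ j
  position-injective {i} {j} e =
    trans (lookup-index (member i)) (trans (cong (lookup vs) e) (sym (lookup-index (member j))))
  collision = FP.pigeonhole short position
  i<j = proj₁ (proj₂ (proj₂ collision))
  fi≡fj = proj₂ (proj₂ (proj₂ collision))

Symmetric : ∀ {n} → EdgeRel n → Set
Symmetric S = ∀ i j → S i j ≡ S j i

_⊆_ : ∀ {n} → EdgeRel n → EdgeRel n → Set
S ⊆ S' = ∀ i j → S i j ≡ true → S' i j ≡ true

_≟ᵇ_ : ∀ {n} → Fin n → Fin n → Bool
i ≟ᵇ j = does (i ≟ j)

≟ᵇ-refl : ∀ {n} (i : Fin n) → (i ≟ᵇ i) ≡ true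
≟ᵇ-refl i with i ≟ i
... | yes _   = refl
... | no  i≢i = ⊥-elim (i≢i refl)

≟ᵇ-true : ∀ {n} {i j : Fin n} → (i ≟ᵇ j) ≡ true → i ≡ j
≟ᵇ-true {i = i} {j} e with i ≟ j
... | yes i≡j = i≡j

SamePair : ∀ {n} → Fin n → Fin n → Fin n → Fin n → Set
SamePair a b i j = (i ≡ a × j ≡ b) ⊎ (i ≡ b × j ≡ a)

edge : ∀ {n} → Fin n → Fin n → EdgeRel n
edge a b i j = ((i ≟ᵇ a) ∧ (j ≟ᵇ b)) ∨ ((i ≟ᵇ b) ∧ (j ≟ᵇ a))

addE : ∀ {n} → Fin n → Fin n → EdgeRel n → EdgeRel n
addE a b S i j = edge a b i j ∨ S i j

∅ : ∀ {n} → EdgeRel n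
∅ _ _ = false

edge-true : ∀ {n} {a b i j : Fin n} → edge a b i j ≡ true → SamePair a b i j
edge-true {a = a} {b} {i} {j} e with ∨-true {(i ≟ᵇ a) ∧ (j ≟ᵇ b)} e
... | inj₁ p = inj₁ (≟ᵇ-true (proj₁ (∧-true p)) , ≟ᵇ-true (proj₂ (∧-true p)))
... | inj₂ p = inj₂ (≟ᵇ-true (proj₁ (∧-true {i ≟ᵇ b} p)) , ≟ᵇ-true (proj₂ (∧-true {i ≟ᵇ b} p)))

edge-self : ∀ {n} (a b : Fin n) → edge a b a b ≡ true
edge-self a b rewrite ≟ᵇ-refl a | ≟ᵇ-refl b = refl

edge-sym : ∀ {n} (a b i j : Fin n) → edge a b i j ≡ edge a b j i
edge-sym a b i j rewrite BP.∧-comm (i ≟ᵇ a) (j ≟ᵇ b) | BP.∧-comm (i ≟ᵇ b) (j ≟ᵇ a) =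
  BP.∨-comm ((j ≟ᵇ b) ∧ (i ≟ᵇ a)) ((j ≟ᵇ a) ∧ (i ≟ᵇ b))

edge-comm : ∀ {n} (a b i j : Fin n) → edge a b i j ≡ edge b a i j
edge-comm a b i j = BP.∨-comm ((i ≟ᵇ a) ∧ (j ≟ᵇ b)) ((i ≟ᵇ b) ∧ (j ≟ᵇ a))

addE-self : ∀ {n} (a b : Fin n) (S : EdgeRel n) → addE a b S a b ≡ true
addE-self a b S = cong (_∨ S a b) (edge-self a b)

addE-⊇ : ∀ {n} {a b : Fin n} {S : EdgeRel n} → S ⊆ addE a b S
addE-⊇ {a = a} {b} i j e = trans (cong (edge a b i j ∨_) e) (BP.∨-zeroʳ _)

addE-sym : ∀ {n} {a b : Fin n} {S : EdgeRel n} → Symmetric S → Symmetric (addE a b S)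
addE-sym {a = a} {b} sym-S i j = cong₂ _∨_ (edge-sym a b i j) (sym-S i j)

addE-cases : ∀ {n} {a b : Fin n} {S : EdgeRel n} {i j} → addE a b S i j ≡ true → SamePair a b i j ⊎ S i j ≡ true
addE-cases {a = a} {b} {S} {i} {j} e with ∨-true {edge a b i j} e
... | inj₁ p = inj₁ (edge-true p)
... | inj₂ p = inj₂ p

addE-fresh : ∀ {n} {a b : Fin n} {S : EdgeRel n} {i j} → S i j ≡ false → ¬ SamePair a b i j → addE a b S i j ≡ false
addE-fresh {a = a} {b} {S} {i} {j} Sij new = not-true λ e → case (addE-cases {a = a} {b} {S} e)
  where
  case : SamePair a b i j ⊎ S i j ≡ true → ⊥
  case (inj₁ same) = new same
  case (inj₂ Sij≡true) with () ← trans (sym Sij) Sij≡true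

edge-count-ordered : ∀ {n} (a b : Fin n) → lt a b ≡ true → sum² (λ i j → 𝟙 (edge a b i j ∧ lt i j)) ≡ 1
edge-count-ordered {n} a b a<b = begin
  sum² (λ i j → 𝟙 (edge a b i j ∧ lt i j))
    ≡⟨ sum²-cong only-at-ab ⟩
  sumℕ (λ i → sumℕ (λ j → if i ≟ᵇ a then 𝟙 (j ≟ᵇ b) else 0))
    ≡⟨ sum-cong (λ i → sum-if (i ≟ᵇ a) (λ j → 𝟙 (j ≟ᵇ b))) ⟩
  sumℕ (λ i → if i ≟ᵇ a then sumℕ (λ j → 𝟙 (j ≟ᵇ b)) else 0)
    ≡⟨ sum-cong (λ i → cong (λ t → if i ≟ᵇ a then t else 0) (sum-delta b (λ _ → 1))) ⟩
  sumℕ (λ i → if i ≟ᵇ a then 1 else 0)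
    ≡⟨ sum-delta a (λ _ → 1) ⟩
  1 ∎
  where
  open ≡-Reasoning
  only-at-ab : ∀ i j → 𝟙 (edge a b i j ∧ lt i j) ≡ (if i ≟ᵇ a then 𝟙 (j ≟ᵇ b) else 0)
  only-at-ab i j with i ≟ a | j ≟ b | i ≟ b | j ≟ a
  ... | yes refl | yes refl | _        | _        = cong 𝟙 a<b
  ... | yes refl | no _     | yes refl | _        with () ← trans (sym (lt-irrefl i)) a<b
  ... | yes refl | no _     | no _     | _        = refl
  ... | no _     | _        | yes refl | yes refl = cong 𝟙 (lt-asym j i a<b)
  ... | no _     | _        | yes _    | no _     = refl
  ... | no _     | _        | no _     | _        = refl
  sum-if : ∀ c (f : Fin n → ℕ) → sumℕ (λ j → if c then f j else 0) ≡ (if c then sumℕ f else 0)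
  sum-if true  f = refl
  sum-if false f = sum-zero {n} (λ _ → refl)

edge-count : ∀ {n} (a b : Fin n) → a ≢ b → sum² (λ i j → 𝟙 (edge a b i j ∧ lt i j)) ≡ 1
edge-count {n} a b a≢b with lt a b in a<b | lt b a in b<a
... | true  | _    = edge-count-ordered a b a<b
... | false | true  = trans (sum²-cong {n} (λ i j → cong (λ t → 𝟙 (t ∧ lt i j)) (edge-comm a b i j)))
                           (edge-count-ordered b a b<a)
... | false | false = ⊥-elim (a≢b (lt-tri a b a<b b<a))

edgeCount-addE : ∀ {n} (S : EdgeRel n) (a b : Fin n) → a ≢ b → Symmetric S → S a b ≡ false →
  edgeCount (addE a b S) ≡ suc (edgeCount S)
edgeCount-addE {n} S a b a≢b sym-S fresh =
  trans (sum²-cong {n} (λ i j → 𝟙-∨ (edge a b i j) (S i j) (lt i j) (disjoint i j)))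
  (trans (sum²-+ {n} _ _) (cong (_+ edgeCount S) (edge-count a b a≢b)))
  where
  disjoint : ∀ i j → edge a b i j ≡ true → S i j ≡ false
  disjoint i j e with edge-true {a = a} {b} {i} {j} e
  ... | inj₁ (refl , refl) = fresh
  ... | inj₂ (refl , refl) = trans (sym-S b a) fresh

edgeCount-∅ : ∀ {n} → edgeCount {n} ∅ ≡ 0
edgeCount-∅ {n} = sum-zero {n} (λ i → sum-zero {n} (λ j → refl))

difference-pos : ∀ {a b} → b < a → ℤ.+ 0 ℤ.< ℤ.+ a ℤ.- ℤ.+ b
difference-pos {a} {b} b<a =
  subst (ℤ.+ 0 ℤ.<_) (sym (trans (ℤP.[+m]-[+n]≡m⊖n a b) (ℤP.⊖-≥ (<⇒≤ b<a)))) (ℤ.+<+ (m<n⇒0<n∸m b<a))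

difference-pos⁻ : ∀ {a b} → ℤ.+ 0 ℤ.< ℤ.+ a ℤ.- ℤ.+ b → b < a
difference-pos⁻ {a} {b} pos with b <? a
... | yes b<a = b<a
... | no  b≮a rewrite ℤP.[+m]-[+n]≡m⊖n a b | ℤP.⊖-≤ (≮⇒≥ b≮a) = ⊥-elim (nonpositive (b ∸ a) pos)
  where
  nonpositive : ∀ x → ¬ (ℤ.+ 0 ℤ.< ℤ.- (ℤ.+ x))
  nonpositive zero    (ℤ.+<+ ())
  nonpositive (suc x) ()

-- Positive and negative edges of a weighted graph.  A Weighing is read on the
-- canonical orientation i < j of each edge; `pos`/`neg` are its symmetric versions.
module SignedEdges {n} (G : Graph n) (w : Weighing n) where

  isPositive : Sign → Bool
  isPositive Sign.+ = true
  isPositive Sign.- = false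

  positive? : Fin n → Fin n → Bool
  positive? i j = isPositive (w i j)

  countEdges : (Fin n → Fin n → Bool) → EdgeRel n → ℕ
  countEdges q S = sum² λ i j → 𝟙 ((S i j ∧ lt i j) ∧ q i j)

  #pos #neg : EdgeRel n → ℕ
  #pos = countEdges positive?
  #neg = countEdges (λ i j → not (positive? i j))

  weightOf-split : ∀ S → weightOf w S ≡ ℤ.+ #pos S ℤ.- ℤ.+ #neg S
  weightOf-split S = trans (sumℤ-cong (λ i → trans (sumℤ-cong (λ j → sign-split (S i j ∧ lt i j) (w i j)))
                                                   (sumℤ-difference {n} _ _)))
                           (sumℤ-difference {n} _ _)
    where
    sumℤ-cong : ∀ {f g : Fin n → ℤ} → (∀ i → f i ≡ g i) → sumℤ f ≡ sumℤ g
    sumℤ-cong {f} {g} h = lemma {n} f g h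
      where
      lemma : ∀ {m} (f g : Fin m → ℤ) → (∀ i → f i ≡ g i) → sumℤ f ≡ sumℤ g
      lemma {zero}  f g h = refl
      lemma {suc m} f g h = cong₂ ℤ._+_ (h F.zero) (lemma (λ i → f (F.suc i)) (λ i → g (F.suc i)) (λ i → h (F.suc i)))
    sumℤ-difference : ∀ {m} (f g : Fin m → ℕ) → sumℤ (λ i → ℤ.+ f i ℤ.- ℤ.+ g i) ≡ ℤ.+ sumℕ f ℤ.- ℤ.+ sumℕ g
    sumℤ-difference {zero}  f g = refl
    sumℤ-difference {suc m} f g =
      trans (cong (λ t → (ℤ.+ f F.zero ℤ.- ℤ.+ g F.zero) ℤ.+ t) (sumℤ-difference (λ i → f (F.suc i)) (λ i → g (F.suc i))))
            (regroup (ℤ.+ f F.zero) (ℤ.+ g F.zero) (ℤ.+ sumℕ (λ i → f (F.suc i))) (ℤ.+ sumℕ (λ i → g (F.suc i))))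
      where
      regroup : ∀ (x y u v : ℤ) → (x ℤ.- y) ℤ.+ (u ℤ.- v) ≡ (x ℤ.+ u) ℤ.- (y ℤ.+ v)
      regroup = ℤSolver.solve-∀
    sign-split : ∀ b s → (if b then signℤ s else ℤ.+ 0) ≡ ℤ.+ 𝟙 (b ∧ isPositive s) ℤ.- ℤ.+ 𝟙 (b ∧ not (isPositive s))
    sign-split true  Sign.+ = refl
    sign-split true  Sign.- = refl
    sign-split false s      = refl

  edgeCount-split : ∀ S → edgeCount S ≡ #pos S + #neg S
  edgeCount-split S = trans (sum²-cong (λ i j → 𝟙-split (S i j ∧ lt i j) (positive? i j))) (sum²-+ {n} _ _)

  onEdges : (Fin n → Fin n → Bool) → Fin n → Fin n → Bool
  onEdges q i j = adj G i j ∧ (if lt i j then q i j else q j i)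

  pos neg : Fin n → Fin n → Bool
  pos = onEdges positive?
  neg = onEdges (λ i j → not (positive? i j))

  P N : Fin n → ℕ
  P x = sumℕ λ y → 𝟙 (pos x y)
  N x = sumℕ λ y → 𝟙 (neg x y)

  onEdges-sym : ∀ q i j → onEdges q i j ≡ onEdges q j i
  onEdges-sym q i j with i ≟ j
  ... | yes refl = refl
  ... | no  i≢j rewrite adjSym G j i with lt i j in i<j | lt j i in j<i
  ... | true  | true  = ⊥-elim (lt-asym-⊥ i j i<j j<i)
  ... | true  | false = refl
  ... | false | true  = refl
  ... | false | false = ⊥-elim (i≢j (lt-tri i j i<j j<i))

  pos-sym : ∀ {x y} → pos y x ≡ true → pos x y ≡ true
  pos-sym {x} {y} = trans (onEdges-sym positive? x y)

  neg-sym : ∀ {x y} → neg y x ≡ true → neg x y ≡ true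
  neg-sym {x} {y} = trans (onEdges-sym (λ i j → not (positive? i j)) x y)

  onEdges-twice : ∀ q → sum² (λ i j → 𝟙 (onEdges q i j)) ≡ countEdges q (adj G) + countEdges q (adj G)
  onEdges-twice q = trans (sum²-cong both-orientations)
    (trans (sum²-+ {n} _ _) (cong (countEdges q (adj G) +_) (sym (sum-swap (λ i j → 𝟙 ((adj G i j ∧ lt i j) ∧ q i j))))))
    where
    both-orientations : ∀ i j → 𝟙 (onEdges q i j) ≡ 𝟙 ((adj G i j ∧ lt i j) ∧ q i j) + 𝟙 ((adj G j i ∧ lt j i) ∧ q j i)
    both-orientations i j rewrite adjSym G j i with lt i j in i<j | lt j i in j<i
    ... | true  | true  = ⊥-elim (lt-asym-⊥ i j i<j j<i)
    ... | true  | false with adj G i j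
    ...   | true  = sym (+-identityʳ _)
    ...   | false = refl
    both-orientations i j | false | true with adj G i j
    ...   | true  = refl
    ...   | false = refl
    both-orientations i j | false | false with lt-tri i j i<j j<i
    ...   | refl rewrite loopless G i = refl

  adj⇒pos⊎neg : ∀ {i j} → adj G i j ≡ true → pos i j ≡ true ⊎ neg i j ≡ true
  adj⇒pos⊎neg {i} {j} e with lt i j
  adj⇒pos⊎neg {i} {j} e | true with positive? i j
  ... | true  = inj₁ (cong (_∧ true) e)
  ... | false = inj₂ (cong (_∧ true) e)
  adj⇒pos⊎neg {i} {j} e | false with positive? j i
  ... | true  = inj₁ (cong (_∧ true) e)
  ... | false = inj₂ (cong (_∧ true) e)

  pos-neg-disjoint : ∀ {i j} → pos i j ≡ true → neg i j ≡ true → ⊥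
  pos-neg-disjoint {i} {j} p q with adj G i j | lt i j
  ... | true | true  = case (positive? i j) (proj₂ (∧-true p)) (proj₂ (∧-true q))
    where
    case : ∀ b → b ≡ true → not b ≡ true → ⊥
    case true  _ ()
  ... | true | false = case (positive? j i) (proj₂ (∧-true p)) (proj₂ (∧-true q))
    where
    case : ∀ b → b ≡ true → not b ≡ true → ⊥
    case true  _ ()

  pos⇒adj : ∀ {i j} → pos i j ≡ true → adj G i j ≡ true
  pos⇒adj p = proj₁ (∧-true p)

  neg⇒adj : ∀ {i j} → neg i j ≡ true → adj G i j ≡ true
  neg⇒adj q = proj₁ (∧-true q)

  positive-if-fewer-negative : sumℕ N < sumℕ P → ℤ.+ 0 ℤ.< weightOf w (adj G)
  positive-if-fewer-negative N<P rewrite weightOf-split (adj G) = difference-pos fewer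
    where
    doubled : #neg (adj G) + #neg (adj G) < #pos (adj G) + #pos (adj G)
    doubled = subst₂ _<_ (onEdges-twice (λ i j → not (positive? i j))) (onEdges-twice positive?) N<P
    fewer : #neg (adj G) < #pos (adj G)
    fewer with #neg (adj G) <? #pos (adj G)
    ... | yes lt' = lt'
    ... | no  ≮  = ⊥-elim (<⇒≱ doubled (+-mono-≤ (≮⇒≥ ≮) (≮⇒≥ ≮)))

adj-irrefl : ∀ {n} (G : Graph n) {a b} → adj G a b ≡ true → a ≢ b
adj-irrefl G {a} Gab refl with () ← trans (sym Gab) (loopless G a)

module NegativeCount {n} (G : Graph n) (w : Weighing n) where
  open SignedEdges G w

  negativeTerm : EdgeRel n → Fin n → Fin n → ℕ
  negativeTerm S p q = 𝟙 ((S p q ∧ lt p q) ∧ not (positive? p q))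

  neg-oriented : ∀ {a b} → neg a b ≡ true → ∀ {t} → lt a b ≡ t →
    (if t then not (positive? a b) else not (positive? b a)) ≡ true
  neg-oriented {a} {b} nab a<b =
    subst (λ t → (if t then not (positive? a b) else not (positive? b a)) ≡ true) a<b (proj₂ (∧-true nab))

  neg-counted : ∀ {S a b} → Symmetric S → S a b ≡ true → neg a b ≡ true →
    ∃₂ λ p q → SamePair a b p q × negativeTerm S p q ≡ 1
  neg-counted {S} {a} {b} sym-S Sab nab = by-orientation (lt a b) refl (lt b a) refl
    where
    by-orientation : ∀ t → lt a b ≡ t → ∀ t' → lt b a ≡ t' → ∃₂ λ p q → SamePair a b p q × negativeTerm S p q ≡ 1
    by-orientation true  a<b _     _   = a , b , inj₁ (refl , refl) , cong 𝟙 (∧₃-true Sab a<b (neg-oriented nab a<b))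
    by-orientation false a≮b true  b<a =
      b , a , inj₂ (refl , refl) , cong 𝟙 (∧₃-true (trans (sym-S b a) Sab) b<a (neg-oriented nab a≮b))
    by-orientation false a≮b false b≮a = ⊥-elim (adj-irrefl G (neg⇒adj nab) (lt-tri a b a≮b b≮a))

  #neg≥1 : ∀ {S a b} → Symmetric S → S a b ≡ true → neg a b ≡ true → 1 ≤ #neg S
  #neg≥1 {S} sym-S Sab nab with neg-counted sym-S Sab nab
  ... | p , q , _ , one = subst (_≤ #neg S) one (term≤sum² (negativeTerm S) p q)

  #neg≥2 : ∀ {S a b c d} → Symmetric S → S a b ≡ true → neg a b ≡ true → S c d ≡ true → neg c d ≡ true →
    ¬ SamePair c d a b → 2 ≤ #neg S
  #neg≥2 {S} sym-S Sab nab Scd ncd different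
    with neg-counted sym-S Sab nab | neg-counted sym-S Scd ncd
  ... | p , q , ab , one | p' , q' , cd , one' =
    subst (_≤ #neg S) (cong₂ _+_ one one') (two-terms≤sum² (negativeTerm S) p q p' q' (distinct ab cd different))
    where
    distinct : ∀ {a b c d p q p' q' : Fin n} → SamePair a b p q → SamePair c d p' q' →
      ¬ SamePair c d a b → ¬ (p ≡ p' × q ≡ q')
    distinct (inj₁ (refl , refl)) (inj₁ (refl , refl)) ne (refl , refl) = ne (inj₁ (refl , refl))
    distinct (inj₁ (refl , refl)) (inj₂ (refl , refl)) ne (refl , refl) = ne (inj₂ (refl , refl))
    distinct (inj₂ (refl , refl)) (inj₁ (refl , refl)) ne (refl , refl) = ne (inj₂ (refl , refl))
    distinct (inj₂ (refl , refl)) (inj₂ (refl , refl)) ne (refl , refl) = ne (inj₁ (refl , refl))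

  #neg-mono : ∀ {S S'} → S ⊆ S' → #neg S ≤ #neg S'
  #neg-mono S⊆S' = sum²-mono λ i j → 𝟙-mono λ e →
    let (Sij∧ordered , negative) = ∧-true e ; (Sij , ordered) = ∧-true Sij∧ordered
    in ∧₃-true (S⊆S' i j Sij) ordered negative

module Pieces {n} (G : Graph n) where

  -- A connected edge set S ⊆ E(G) with m edges.  Its vertices are listed (two per
  -- edge, possibly repeated) and all reachable inside S from a root.
  record Piece (S : EdgeRel n) (m : ℕ) : Set where
    field
      symmetric       : Symmetric S
      inside          : S ⊆ adj G
      size            : edgeCount S ≡ m
      vertices        : List (Fin n)
      vertices-length : length vertices ≡ m + m
      vertices-cover  : ∀ u → Incident S u → u ∈ vertices
      root            : Fin n
      root-incident   : Incident S root
      root-reaches    : ∀ u → Incident S u → Reach S root u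
  open Piece public

  piece-connected : ∀ {S m} → Piece S m → SubConnected S
  piece-connected π u v iu iv = reach-trans (reach-sym (symmetric π) (root-reaches π u iu)) (root-reaches π v iv)

  attach : ∀ {S m} → Piece S m → ∀ {u x} → Incident S u → S u x ≡ false → adj G u x ≡ true →
    Piece (addE u x S) (suc m)
  attach {S} {m} π {u} {x} iu fresh Gux = record
    { symmetric       = addE-sym (symmetric π)
    ; inside          = inside'
    ; size            = trans (edgeCount-addE S u x (adj-irrefl G Gux) (symmetric π) fresh) (cong suc (size π))
    ; vertices        = u ∷ x ∷ vertices π
    ; vertices-length = trans (cong (λ t → suc (suc t)) (vertices-length π)) (cong suc (sym (+-suc m m)))
    ; vertices-cover  = cover
    ; root            = root π
    ; root-incident   = proj₁ (root-incident π) , addE-⊇ {a = u} {x} {S} _ _ (proj₂ (root-incident π))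
    ; root-reaches    = reaches }
    where
    inside' : addE u x S ⊆ adj G
    inside' i j e with addE-cases {a = u} {x} {S} e
    ... | inj₁ (inj₁ (refl , refl)) = Gux
    ... | inj₁ (inj₂ (refl , refl)) = trans (adjSym G x u) Gux
    ... | inj₂ Sij                  = inside π i j Sij
    cover : ∀ v → Incident (addE u x S) v → v ∈ (u ∷ x ∷ vertices π)
    cover v (z , e) with addE-cases {a = u} {x} {S} e
    ... | inj₁ (inj₁ (refl , refl)) = here refl
    ... | inj₁ (inj₂ (refl , refl)) = there (here refl)
    ... | inj₂ Svz                  = there (there (vertices-cover π v (z , Svz)))
    reaches : ∀ v → Incident (addE u x S) v → Reach (addE u x S) (root π) v
    reaches v (z , e) with addE-cases {a = u} {x} {S} e
    ... | inj₁ (inj₁ (refl , refl)) = reach-mono addE-⊇ (root-reaches π u iu)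
    ... | inj₁ (inj₂ (refl , refl)) = reach-trans (reach-mono addE-⊇ (root-reaches π u iu)) (step (addE-self u x S) here)
    ... | inj₂ Svz                  = reach-mono addE-⊇ (root-reaches π v (z , Svz))

  single-edge : ∀ {a b} → adj G a b ≡ true → Piece (addE a b ∅) 1
  single-edge {a} {b} Gab = record
    { symmetric       = addE-sym (λ _ _ → refl)
    ; inside          = inside'
    ; size            = trans (edgeCount-addE ∅ a b (adj-irrefl G Gab) (λ _ _ → refl) refl) (cong suc (edgeCount-∅ {n}))
    ; vertices        = a ∷ b ∷ []
    ; vertices-length = refl
    ; vertices-cover  = cover
    ; root            = a
    ; root-incident   = b , addE-self a b ∅
    ; root-reaches    = reaches }
    where
    inside' : addE a b ∅ ⊆ adj G
    inside' i j e with addE-cases {a = a} {b} {∅} {i} {j} e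
    ... | inj₁ (inj₁ (refl , refl)) = Gab
    ... | inj₁ (inj₂ (refl , refl)) = trans (adjSym G b a) Gab
    cover : ∀ v → Incident (addE a b ∅) v → v ∈ (a ∷ b ∷ [])
    cover v (z , e) with addE-cases {a = a} {b} {∅} {v} {z} e
    ... | inj₁ (inj₁ (refl , refl)) = here refl
    ... | inj₁ (inj₂ (refl , refl)) = there (here refl)
    reaches : ∀ v → Incident (addE a b ∅) v → Reach (addE a b ∅) a v
    reaches v (z , e) with addE-cases {a = a} {b} {∅} {v} {z} e
    ... | inj₁ (inj₁ (refl , refl)) = here
    ... | inj₁ (inj₂ (refl , refl)) = step (addE-self a b ∅) here

  exit-edge : ∀ {S} → Symmetric S → ∀ {u v} → Reach (adj G) u v → Incident S u → ¬ Incident S v →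
    ∃₂ λ u' x → Incident S u' × S u' x ≡ false × adj G u' x ≡ true
  exit-edge sym-S here iu ¬iv = ⊥-elim (¬iv iu)
  exit-edge {S} sym-S (step {u} {y} Guy r) iu ¬iv with S u y in Suy
  ... | false = u , y , iu , Suy , Guy
  ... | true  = exit-edge sym-S r (u , trans (sym-S y u) Suy) ¬iv

  -- In a connected graph with n ≥ 2k vertices, every piece with m ≤ k edges
  -- extends to a piece with exactly k edges: a piece with fewer than k edges
  -- lists fewer than n vertices, so some edge leaves it.
  grow : Connected G → ∀ {k} → k + k ≤ n → ∀ {S m} → Piece S m → m ≤ k → ∃ λ S' → Piece S' k × S ⊆ S'
  grow conn {k} 2k≤n {S} {m} π m≤k = go (k ∸ m) π (m∸n+n≡m m≤k)
    where
    go : ∀ d {S m} → Piece S m → d + m ≡ k → ∃ λ S' → Piece S' k × S ⊆ S'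
    go zero    {S} π refl = S , π , (λ _ _ e → e)
    go (suc d) {S} {m} π d+m≡k
      with outside (vertices π) (≤-trans (s≤s (≤-reflexive (vertices-length π))) few-vertices)
      where
      few-vertices : suc (m + m) ≤ n
      few-vertices = ≤-trans (+-mono-≤ (m≤n+m (suc m) d) (m≤n+m m (suc d)))
        (≤-trans (≤-reflexive (cong₂ _+_ (trans (+-suc d m) d+m≡k) d+m≡k)) 2k≤n)
    ... | v , v∉π with exit-edge (symmetric π) (conn (root π) v) (root-incident π) (λ iv → v∉π (vertices-cover π v iv))
    ... | u , x , iu , fresh , Gux with go d (attach π iu fresh Gux) (trans (+-suc d m) d+m≡k)
    ... | S' , π' , S⊆S' = S' , π' , (λ i j e → S⊆S' i j (addE-⊇ {a = u} {x} {S} i j e))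

module LocalPositivity {n} (G : Graph n) (w : Weighing n) (conn : Connected G)
                       {k} (2k≤n : k + k ≤ n) (local : LocalPositive k G w) where
  open SignedEdges G w
  open NegativeCount G w
  open Pieces G

  -- No piece with at most k edges contains t negative edges where k ≤ 2t:
  -- extend it to k edges; then at least half of them are negative.
  no-heavy-piece : ∀ {S m t} → Piece S m → m ≤ k → t ≤ #neg S → k ≤ t + t → ⊥
  no-heavy-piece {t = t} π m≤k t≤neg k≤2t with grow conn 2k≤n π m≤k
  ... | S' , π' , S⊆S' = <⇒≱ more-positive (+-cancelʳ-≤ (#neg S') (#pos S') (#neg S') split≤)
    where
    more-positive : #neg S' < #pos S'
    more-positive = difference-pos⁻ (subst (ℤ.+ 0 ℤ.<_) (weightOf-split S')
      (local S' (symmetric π' , inside π') (piece-connected π') (size π')))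
    t≤neg' : t ≤ #neg S'
    t≤neg' = ≤-trans t≤neg (#neg-mono S⊆S')
    split≤ : #pos S' + #neg S' ≤ #neg S' + #neg S'
    split≤ = ≤-trans (≤-reflexive (trans (sym (edgeCount-split S')) (size π')))
                     (≤-trans k≤2t (+-mono-≤ t≤neg' t≤neg'))

  no-negative-edge : 1 ≤ k → k ≤ 2 → ∀ {a b} → neg a b ≡ true → ⊥
  no-negative-edge 1≤k k≤2 {a} {b} nab =
    no-heavy-piece (single-edge (neg⇒adj nab)) 1≤k (#neg≥1 (addE-sym (λ _ _ → refl)) (addE-self a b ∅) nab) k≤2

  no-negative-cherry : 3 ≤ k → k ≤ 4 → ∀ {x y z} → neg x y ≡ true → neg x z ≡ true → y ≢ z → ⊥
  no-negative-cherry 3≤k k≤4 {x} {y} {z} nxy nxz y≢z =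
    no-heavy-piece π (≤-trans (s≤s (s≤s z≤n)) 3≤k)
      (#neg≥2 (symmetric π) (addE-⊇ {a = x} {z} {S₁} x y (addE-self x y ∅)) nxy (addE-self x z S₁) nxz different) k≤4
    where
    S₁ = addE x y ∅
    x≢y = adj-irrefl G (neg⇒adj nxy)
    new : ¬ SamePair x y x z
    new (inj₁ (_ , z≡y)) = y≢z (sym z≡y)
    new (inj₂ (x≡y , _)) = x≢y x≡y
    π = attach (single-edge (neg⇒adj nxy)) (y , addE-self x y ∅)
               (addE-fresh {S = ∅} refl new) (neg⇒adj nxz)
    different : ¬ SamePair x z x y
    different (inj₁ (_ , y≡z)) = y≢z y≡z
    different (inj₂ (x≡z , _)) = adj-irrefl G (neg⇒adj nxz) x≡z

  no-negative-path : 3 ≤ k → k ≤ 4 → ∀ {a x y b} → neg a x ≡ true → pos x y ≡ true → neg y b ≡ true → ⊥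
  no-negative-path 3≤k k≤4 {a} {x} {y} {b} nax pxy nyb =
    no-heavy-piece π₃ 3≤k
      (#neg≥2 (symmetric π₃) (addE-⊇ {a = y} {b} {S₂} a x (addE-⊇ {a = x} {y} {S₁} a x (addE-self a x ∅))) nax
              (addE-self y b S₂) nyb different) k≤4
    where
    S₁ = addE a x ∅
    S₂ = addE x y S₁
    Gxy = pos⇒adj pxy
    new₂ : ¬ SamePair a x x y
    new₂ (inj₁ (x≡a , y≡x)) = adj-irrefl G Gxy (sym y≡x)
    new₂ (inj₂ (_ , refl))  = pos-neg-disjoint pxy (neg-sym nax)
    new₃ : ¬ SamePair x y y b
    new₃ (inj₁ (y≡x , _))   = adj-irrefl G Gxy (sym y≡x)
    new₃ (inj₂ (_ , refl))  = pos-neg-disjoint pxy (neg-sym nyb)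
    fresh₃ : S₁ y b ≡ false
    fresh₃ = addE-fresh {a = a} {x} {∅} {y} {b} refl λ
      { (inj₁ (refl , refl)) → pos-neg-disjoint pxy (neg-sym nyb)
      ; (inj₂ (y≡x , _))     → adj-irrefl G Gxy (sym y≡x) }
    π₂ = attach (single-edge (neg⇒adj nax)) (a , trans (addE-sym (λ _ _ → refl) x a) (addE-self a x ∅))
                (addE-fresh {S = ∅} refl new₂) Gxy
    π₃ = attach π₂ (x , trans (symmetric π₂ y x) (addE-self x y S₁)) (addE-fresh {S = S₁} fresh₃ new₃) (neg⇒adj nyb)
    different : ¬ SamePair y b a x
    different (inj₁ (refl , refl)) = pos-neg-disjoint pxy (neg-sym nax)
    different (inj₂ (_ , x≡y))     = adj-irrefl G Gxy x≡y

  N≤1 : 1 ≤ k → k ≤ 4 → ∀ x → N x ≤ 1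
  N≤1 1≤k k≤4 x = count≤1 (neg x) unique
    where
    unique : ∀ y z → neg x y ≡ true → neg x z ≡ true → y ≡ z
    unique y z nxy nxz with k ≤? 2 | y ≟ z
    ... | yes k≤2 | _        = ⊥-elim (no-negative-edge 1≤k k≤2 nxy)
    ... | no  _   | yes y≡z  = y≡z
    ... | no  k≰2 | no  y≢z  = ⊥-elim (no-negative-cherry (≰⇒> k≰2) k≤4 nxy nxz y≢z)

  N+N≤1 : 1 ≤ k → k ≤ 4 → ∀ {x y} → pos x y ≡ true → N x + N y ≤ 1
  N+N≤1 1≤k k≤4 {x} {y} pxy with 1 ≤? N x | 1 ≤? N y
  ... | no Nx≱1 | _       rewrite ≱1⇒≡0 Nx≱1 = N≤1 1≤k k≤4 y
  ... | yes _   | no Ny≱1 rewrite ≱1⇒≡0 Ny≱1 | +-identityʳ (N x) = N≤1 1≤k k≤4 x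
  ... | yes Nx≥1 | yes Ny≥1 with count-witness (neg x) Nx≥1 | count-witness (neg y) Ny≥1 | k ≤? 2
  ...   | a , nxa | b , nyb | yes k≤2 = ⊥-elim (no-negative-edge 1≤k k≤2 nxa)
  ...   | a , nxa | b , nyb | no  k≰2 = ⊥-elim (no-negative-path (≰⇒> k≰2) k≤4 (neg-sym nxa) pxy nyb)

WithinTwo : ∀ {n} → Graph n → Fin n → Fin n → Set
WithinTwo G c v = v ≡ c ⊎ adj G c v ≡ true ⊎ ∃ λ m → adj G c m ≡ true × adj G m v ≡ true

moore-bound : ∀ {n} (G : Graph n) Δ → MaxDegreeAtMost G Δ → ∀ c → (∀ v → WithinTwo G c v) → n ≤ 1 + Δ + Δ * Δ
moore-bound {n} G Δ maxdeg c near = begin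
  n                                          ≡⟨ sum-ones n ⟨
  sumℕ {n} (λ _ → 1)                         ≤⟨ sum-mono (λ v → counted v (near v)) ⟩
  sumℕ (λ v → 𝟙 (v ≟ᵇ c) + 𝟙 (adj G c v) + paths v)
    ≡⟨ trans (sum-+ _ paths) (cong (_+ sumℕ paths) (sum-+ (λ v → 𝟙 (v ≟ᵇ c)) (λ v → 𝟙 (adj G c v)))) ⟩
  sumℕ (λ v → 𝟙 (v ≟ᵇ c)) + degree G c + sumℕ paths
    ≤⟨ +-mono-≤ (+-mono-≤ (≤-reflexive (sum-delta c (λ _ → 1))) (maxdeg c)) two-steps ⟩
  1 + Δ + Δ * Δ                              ∎
  where
  open ≤-Reasoning
  paths : Fin n → ℕ
  paths v = sumℕ (λ m → 𝟙 (adj G c m) * 𝟙 (adj G m v))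
  counted : ∀ v → WithinTwo G c v → 1 ≤ 𝟙 (v ≟ᵇ c) + 𝟙 (adj G c v) + paths v
  counted v (inj₁ refl) rewrite ≟ᵇ-refl v = s≤s z≤n
  counted v (inj₂ (inj₁ Gcv)) rewrite Gcv = ≤-trans (m≤n+m 1 (𝟙 (v ≟ᵇ c))) (m≤m+n _ (paths v))
  counted v (inj₂ (inj₂ (m , Gcm , Gmv))) =
    ≤-trans (≤-reflexive (sym (cong₂ (λ p q → 𝟙 p * 𝟙 q) Gcm Gmv)))
            (≤-trans (term≤sum (λ m → 𝟙 (adj G c m) * 𝟙 (adj G m v)) m) (m≤n+m _ _))
  two-steps : sumℕ paths ≤ Δ * Δ
  two-steps = begin
    sumℕ paths                                       ≡⟨ sum-swap (λ v m → 𝟙 (adj G c m) * 𝟙 (adj G m v)) ⟩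
    sumℕ (λ m → sumℕ (λ v → 𝟙 (adj G c m) * 𝟙 (adj G m v)))
      ≡⟨ sum-cong (λ m → sum-*ˡ (λ v → 𝟙 (adj G m v)) (𝟙 (adj G c m))) ⟩
    sumℕ (λ m → 𝟙 (adj G c m) * degree G m)          ≤⟨ sum-mono (λ m → *-monoʳ-≤ (𝟙 (adj G c m)) (maxdeg m)) ⟩
    sumℕ (λ m → 𝟙 (adj G c m) * Δ)                   ≡⟨ sum-*ʳ (λ m → 𝟙 (adj G c m)) Δ ⟩
    degree G c * Δ                                   ≤⟨ *-monoˡ-≤ Δ (maxdeg c) ⟩
    Δ * Δ                                            ∎

module Charging {n} (G : Graph n) (w : Weighing n) (conn : Connected G) (3≤n : 3 ≤ n) where
  open SignedEdges G w

  weighted-degree-sum : (R : Fin n → Fin n → Bool) → (∀ x y → R x y ≡ R y x) → (h : Fin n → ℕ) →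
    sum² (λ x y → 𝟙 (R x y) * (h x + h y)) ≡
    sumℕ (λ x → sumℕ (λ y → 𝟙 (R x y)) * h x) + sumℕ (λ x → sumℕ (λ y → 𝟙 (R x y)) * h x)
  weighted-degree-sum R R-sym h = begin
    sum² (λ x y → 𝟙 (R x y) * (h x + h y))
      ≡⟨ sum²-cong (λ x y → *-distribˡ-+ (𝟙 (R x y)) (h x) (h y)) ⟩
    sum² (λ x y → 𝟙 (R x y) * h x + 𝟙 (R x y) * h y)
      ≡⟨ sum²-+ {n} _ _ ⟩
    sum² (λ x y → 𝟙 (R x y) * h x) + sum² (λ x y → 𝟙 (R x y) * h y)
      ≡⟨ cong₂ _+_ (sum-cong (λ x → sum-*ʳ (λ y → 𝟙 (R x y)) (h x))) second ⟩
    sumℕ (λ x → sumℕ (λ y → 𝟙 (R x y)) * h x) + sumℕ (λ x → sumℕ (λ y → 𝟙 (R x y)) * h x) ∎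
    where
    open ≡-Reasoning
    second : sum² (λ x y → 𝟙 (R x y) * h y) ≡ sumℕ (λ x → sumℕ (λ y → 𝟙 (R x y)) * h x)
    second = trans (sum-swap (λ x y → 𝟙 (R x y) * h y))
      (sum-cong (λ y → trans (sum-*ʳ (λ x → 𝟙 (R x y)) (h y))
                             (cong (_* h y) (sum-cong (λ x → cong 𝟙 (R-sym x y))))))

  module _ (N≤1 : ∀ x → N x ≤ 1) (N+N≤1 : ∀ {x y} → pos x y ≡ true → N x + N y ≤ 1) where

    neg-unique : ∀ {x y z} → neg x y ≡ true → neg x z ≡ true → y ≡ z
    neg-unique {x} {y} {z} = count≤1⇒unique (neg x) (N≤1 x) y z

    -- A negative edge has a positive edge at one of its ends: otherwise its two
    -- ends would form a whole component of G, which has n ≥ 3 vertices.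
    P+P≥1 : ∀ {x y} → neg x y ≡ true → 1 ≤ P x + P y
    P+P≥1 {x} {y} nxy with 1 ≤? P x + P y
    ... | yes ≥1 = ≥1
    ... | no  ≱1 with outside (x ∷ y ∷ []) 3≤n
    ... | v , v∉xy = ⊥-elim (v∉xy (as-member (reach-closed Ends closed (inj₁ refl) (conn x v))))
      where
      Ends : Fin n → Set
      Ends u = u ≡ x ⊎ u ≡ y
      P≡0 : ∀ {u} → Ends u → P u ≡ 0
      P≡0 (inj₁ refl) = m+n≡0⇒m≡0 (P x) (≱1⇒≡0 ≱1)
      P≡0 (inj₂ refl) = m+n≡0⇒n≡0 (P x) (≱1⇒≡0 ≱1)
      only-negative : ∀ {u z} → Ends u → adj G u z ≡ true → neg u z ≡ true
      only-negative {u} {z} eu Guz with adj⇒pos⊎neg {u} {z} Guz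
      ... | inj₁ puz = ⊥-elim (1+n≰n (≤-trans (witness⇒count (pos u) puz) (≤-reflexive (P≡0 eu))))
      ... | inj₂ nuz = nuz
      closed : ∀ u z → Ends u → adj G u z ≡ true → Ends z
      closed u z (inj₁ refl) Guz = inj₂ (sym (neg-unique nxy (only-negative (inj₁ refl) Guz)))
      closed u z (inj₂ refl) Guz = inj₁ (sym (neg-unique (neg-sym nxy) (only-negative (inj₂ refl) Guz)))
      as-member : ∀ {u} → Ends u → u ∈ (x ∷ y ∷ [])
      as-member (inj₁ e) = here e
      as-member (inj₂ e) = there (here e)

    A : ℕ
    A = sumℕ (λ x → N x * P x)

    charge-negative : sum² (λ x y → 𝟙 (neg x y) * (P x + P y)) ≡ A + A
    charge-negative = weighted-degree-sum neg (onEdges-sym (λ i j → not (positive? i j))) P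

    charge-positive : sum² (λ x y → 𝟙 (pos x y) * (N x + N y)) ≡ A + A
    charge-positive = trans (weighted-degree-sum pos (onEdges-sym positive?) N)
                            (cong (λ t → t + t) (sum-cong (λ x → *-comm (P x) (N x))))

    N≤A+A : sumℕ N ≤ A + A
    N≤A+A = ≤-trans (sum²-mono (λ x y → 𝟙≤𝟙* (neg x y) _ P+P≥1)) (≤-reflexive charge-negative)

    A+A≤P : A + A ≤ sumℕ P
    A+A≤P = ≤-trans (≤-reflexive (sym charge-positive)) (sum²-mono (λ x y → 𝟙*≤𝟙 (pos x y) _ N+N≤1))

    record Tight : Set where
      field
        neg-tight : ∀ {x y} → neg x y ≡ true → P x + P y ≤ 1
        pos-tight : ∀ {x y} → pos x y ≡ true → 1 ≤ N x + N y

    loose-negative? : Dec (∃₂ λ x y → neg x y ≡ true × 2 ≤ P x + P y)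
    loose-negative? = FP.any? λ x → FP.any? λ y → (neg x y 𝔹.≟ true) ×-dec (2 ≤? P x + P y)
    loose-positive? : Dec (∃₂ λ x y → pos x y ≡ true × N x + N y ≡ 0)
    loose-positive? = FP.any? λ x → FP.any? λ y → (pos x y 𝔹.≟ true) ×-dec (N x + N y ℕ.≟ 0)

    fewer-negative-unless-tight : ¬ Tight → sumℕ N < sumℕ P
    fewer-negative-unless-tight ¬tight with loose-negative? | loose-positive?
    ... | yes (x , y , nxy , 2≤) | _ =
      <-≤-trans (<-≤-trans (sum²-mono-< (λ x y → 𝟙≤𝟙* (neg x y) _ P+P≥1) x y (strict nxy 2≤))
                           (≤-reflexive charge-negative)) A+A≤P
      where
      strict : ∀ {x y} → neg x y ≡ true → 2 ≤ P x + P y → 𝟙 (neg x y) < 𝟙 (neg x y) * (P x + P y)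
      strict nxy 2≤ rewrite nxy = ≤-trans 2≤ (≤-reflexive (sym (+-identityʳ _)))
    ... | no _ | yes (x , y , pxy , N0) =
      ≤-<-trans N≤A+A (≤-<-trans (≤-reflexive (sym charge-positive))
                                 (sum²-mono-< (λ x y → 𝟙*≤𝟙 (pos x y) _ N+N≤1) x y (strict pxy N0)))
      where
      strict : ∀ {x y} → pos x y ≡ true → N x + N y ≡ 0 → 𝟙 (pos x y) * (N x + N y) < 𝟙 (pos x y)
      strict pxy N0 rewrite pxy | N0 = s≤s z≤n
    ... | no ¬loose-neg | no ¬loose-pos = ⊥-elim (¬tight (record { neg-tight = neg-tight ; pos-tight = pos-tight }))
      where
      neg-tight : ∀ {x y} → neg x y ≡ true → P x + P y ≤ 1
      neg-tight {x} {y} nxy with 2 ≤? P x + P y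
      ... | yes 2≤ = ⊥-elim (¬loose-neg (x , y , nxy , 2≤))
      ... | no  2≰ = ≤-pred (≰⇒> 2≰)
      pos-tight : ∀ {x y} → pos x y ≡ true → 1 ≤ N x + N y
      pos-tight {x} {y} pxy with 1 ≤? N x + N y
      ... | yes 1≤ = 1≤
      ... | no  1≰ = ⊥-elim (¬loose-pos (x , y , pxy , ≱1⇒≡0 1≰))

    -- Some edge is positive: take any edge, and if it is negative, a positive
    -- edge at one of its ends.
    some-positive-edge : ∃₂ λ p q → pos p q ≡ true
    some-positive-edge with connected-has-edge G (≤-trans (s≤s (s≤s z≤n)) 3≤n) conn
    ... | a , b , Gab with adj⇒pos⊎neg Gab
    ...   | inj₁ pab = a , b , pab
    ...   | inj₂ nab with 1 ≤? P a
    ...     | yes Pa≥1 = a , count-witness (pos a) Pa≥1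
    ...     | no  Pa≱1 = b , count-witness (pos b) (subst (λ t → 1 ≤ t + P b) (≱1⇒≡0 Pa≱1) (P+P≥1 nab))

    -- Some vertex has no negative edge: an end of a positive edge.
    centre : ∃ λ c → N c ≡ 0
    centre with some-positive-edge
    ... | p , q , ppq with 1 ≤? N p
    ...   | no  Np≱1 = p , ≱1⇒≡0 Np≱1
    ...   | yes Np≥1 = q , n≤0⇒n≡0 (+-cancelˡ-≤ 1 _ _ (≤-trans (+-monoˡ-≤ (N q) Np≥1) (N+N≤1 ppq)))

    -- Tight charging around a vertex c without negative edges: every neighbour m
    -- of c is joined positively to c, has no further positive edge, and has a
    -- negative partner without positive edges.  So no walk leaves distance two.
    module AroundCentre (tight : Tight) (c : Fin n) (Nc≡0 : N c ≡ 0) where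
      open Tight tight

      positive-at-centre : ∀ {m} → adj G c m ≡ true → pos c m ≡ true
      positive-at-centre Gcm with adj⇒pos⊎neg Gcm
      ... | inj₁ pcm = pcm
      ... | inj₂ ncm with () ← ≤-trans (witness⇒count (neg c) ncm) (≤-reflexive Nc≡0)

      record Neighbour (m : Fin n) : Set where
        field
          to-centre    : pos m c ≡ true
          partner      : Fin n
          neg-partner  : neg m partner ≡ true
          P≤1          : P m ≤ 1
          partner-P≡0  : P partner ≡ 0

      neighbour : ∀ {m} → adj G c m ≡ true → Neighbour m
      neighbour {m} Gcm = record
        { to-centre   = pmc
        ; partner     = proj₁ partner
        ; neg-partner = proj₂ partner
        ; P≤1         = m+n≤o⇒m≤o (P m) tight-at-partner
        ; partner-P≡0 = n≤0⇒n≡0 (+-cancelˡ-≤ 1 _ _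
                          (≤-trans (+-monoˡ-≤ (P (proj₁ partner)) (witness⇒count (pos m) pmc)) tight-at-partner)) }
        where
        pmc = pos-sym (positive-at-centre Gcm)
        partner = count-witness (neg m) (subst (λ t → 1 ≤ t + N m) Nc≡0 (pos-tight (positive-at-centre Gcm)))
        tight-at-partner = neg-tight (proj₂ partner)

      within-two-closed : ∀ v u → WithinTwo G c v → adj G v u ≡ true → WithinTwo G c u
      within-two-closed v u (inj₁ refl)                  Gvu = inj₂ (inj₁ Gvu)
      within-two-closed v u (inj₂ (inj₁ Gcv))            Gvu = inj₂ (inj₂ (v , Gcv , Gvu))
      within-two-closed v u (inj₂ (inj₂ (m , Gcm , Gmv))) Gvu with adj⇒pos⊎neg Gmv
      ... | inj₁ pmv = inj₂ (inj₁ (subst (λ t → adj G t u ≡ true) v≡c Gvu))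
        where
        open Neighbour (neighbour Gcm)
        v≡c = count≤1⇒unique (pos m) P≤1 v c pmv to-centre
      ... | inj₂ nmv = from-partner (neg-unique nmv neg-partner) Gvu
        where
        open Neighbour (neighbour Gcm)
        from-partner : v ≡ partner → adj G v u ≡ true → WithinTwo G c u
        from-partner refl Gvu' with adj⇒pos⊎neg Gvu'
        ... | inj₁ pvu = ⊥-elim (1+n≰n (≤-trans (witness⇒count (pos v) pvu) (≤-reflexive partner-P≡0)))
        ... | inj₂ nvu = inj₂ (inj₁ (subst (λ t → adj G c t ≡ true) (sym (neg-unique nvu (neg-sym neg-partner))) Gcm))

      within-two : ∀ v → WithinTwo G c v
      within-two v = reach-closed (WithinTwo G c) within-two-closed (inj₁ refl) (conn c v)

    tight⇒small : Tight → ∀ Δ → MaxDegreeAtMost G Δ → n ≤ 1 + Δ + Δ * Δ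
    tight⇒small tight Δ maxdeg = moore-bound G Δ maxdeg c (AroundCentre.within-two tight c Nc≡0)
      where
      c = proj₁ centre
      Nc≡0 = proj₂ centre

positive-weight : ∀ {n} (G : Graph n) (w : Weighing n) → Connected G →
  ∀ Δ → MaxDegreeAtMost G Δ → 1 + Δ + Δ * Δ < n → 3 ≤ n →
  ∀ {k} → 1 ≤ k → k ≤ 4 → k + k ≤ n → LocalPositive k G w → ℤ.+ 0 ℤ.< weightOf w (adj G)
positive-weight G w conn Δ maxdeg large 3≤n 1≤k k≤4 2k≤n local =
  positive-if-fewer-negative (fewer-negative-unless-tight N≤1′ N+N≤1′ λ tight →
    <⇒≱ large (tight⇒small N≤1′ N+N≤1′ tight Δ maxdeg))
  where
  open SignedEdges G w
  open LocalPositivity G w conn 2k≤n local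
  open Charging G w conn 3≤n
  N≤1′ : ∀ x → N x ≤ 1
  N≤1′ = N≤1 1≤k k≤4
  N+N≤1′ : ∀ {x y} → pos x y ≡ true → N x + N y ≤ 1
  N+N≤1′ = N+N≤1 1≤k k≤4

-- Lemma 4.1: every k ∈ {1,…,4} is forcing for every family between the trees and
-- the connected graphs of maximum degree Δ ≥ 3; graphs with n ≥ Δ² + Δ + 2
-- vertices are all covered by the main estimate.
lemma4p1 : ∀ (k : ℕ) → 1 ≤ k → k ≤ 4 → ∀ (Δ : ℕ) → 3 ≤ Δ → ∀ (𝒢 : Family) →
    (∀ n (G : Graph n) → IsTree G → MaxDegreeAtMost G Δ → 𝒢 n G) →
    (∀ n (G : Graph n) → 𝒢 n G → Connected G × MaxDegreeAtMost G Δ) →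
    Forcing k 𝒢
lemma4p1 k 1≤k k≤4 Δ 3≤Δ 𝒢 _ bounded = 2 + Δ + Δ * Δ , λ n large G G∈𝒢 w local →
  let (conn , maxdeg) = bounded n G G∈𝒢
      8≤n = ≤-trans 8≤threshold large
  in positive-weight G w conn Δ maxdeg large (≤-trans (m≤m+n 3 5) 8≤n) 1≤k k≤4
                     (≤-trans (+-mono-≤ k≤4 k≤4) 8≤n) local
  where
  8≤threshold : 8 ≤ 2 + Δ + Δ * Δ
  8≤threshold = ≤-trans (m≤m+n 8 6) (+-mono-≤ (+-monoʳ-≤ 2 3≤Δ) (*-mono-≤ 3≤Δ 3≤Δ))
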